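{- Let $(G,\mu)$ be a connected assigned graph with cutoff $\rho$ and let $T_{(G,\mu)}$ be its Gallavotti–Nicolò tree. Then: (1) the root of $T_{(G,\mu)}$ is decorated with $G$ itself; (2) all leaves of $T_{(G,\mu)}$ are at distance $\rho$ from the root; (3) if $j\le k$ are scales such that no scale $i$ with $j\le i\le k$ appears in $(G,\mu)$, then any subtree of $T_{(G,\mu)}$ whose root is at distance $j$ and whose leaves are at distance $k$ from the root of $T_{(G,\mu)}$ does not branch and has all its nodes decorated by the same graph.
   Context: A scalar $\phi^4$ Feynman graph has $4$-valent vertices, internal edges (joining two half-edges) and external edges (unpaired half-edges). Fix an integer cutoff $\rho\ge 0$. An assigned graph $(G,\mu)$ is an isomorphism class of pairs consisting of a one-particle-irreducible (connected and remaining connected after deletion of any internal edge) Feynman graph $G$ and a scale assignment $\mu$ giving each edge an integer scale in $\{0,\dots,\rho\}$. For a subgraph $g$ (a set of internal edges with their end vertices, external edges being the other edges of $G$ incident to vertices of $g$), let $i_g$ be the minimal scale of its internal edges and $e_g$ the maximal scale of its external edges; $g$ is high if it is connected and $e_g<i_g$. The Gallavotti–Nicolò tree $T_{(G,\mu)}$ is the rooted tree whose nodes at distance $i$ ($0\le i\le\rho$) from the root are decorated by the connected high subgraphs $G^i_c$ of $G$ formed by the edges of scale $\ge i$ (the connected components of the subgraph of $G$ made of its internal edges of scale $\ge i$), and in which an arrow joins the node decorated by $G^i_c$ to the node decorated by $G^{i-1}_{c'}$ if and only if $G^i_c$ is a high subgraph of $G^{i-1}_{c'}$. -}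

module Defs where

open import Data.Nat using (ℕ; zero; suc; _+_; _≤_)
open import Data.Fin using (Fin; _≟_)
open import Data.List using (List; map; allFin)
open import Data.Nat.ListAction using (sum)
open import Data.Product using (Σ; _×_; _,_; proj₁; proj₂)
open import Data.Sum using (_⊎_)
open import Data.Unit using (⊤)
open import Relation.Nullary using (¬_; Dec; yes; no)
open import Relation.Binary.PropositionalEquality using (_≡_)
open import Function.Bundles using (_⇔_)

ind : ∀ {p} {P : Set p} → Dec P → ℕ
ind (yes _) = 1
ind (no _)  = 0

Σ[_]_ : ∀ (n : ℕ) → (Fin n → ℕ) → ℕ
Σ[ n ] f = sum (map f (allFin n))

-- A scalar φ⁴ Feynman graph: vertices Fin nV, internal edges Fin nI
-- (each joining two vertices, i.e. two half-edges; loops allowed),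
-- external edges Fin nX (unpaired half-edges, each attached to a vertex),
-- every vertex 4-valent (a loop counts twice).
record FeynmanGraph : Set where
  field
    nV nI nX : ℕ
    ends     : Fin nI → Fin nV × Fin nV
    leg      : Fin nX → Fin nV
  degree : Fin nV → ℕ
  degree v = Σ[ nI ] (λ e → ind (proj₁ (ends e) ≟ v) + ind (proj₂ (ends e) ≟ v))
           + Σ[ nX ] (λ x → ind (leg x ≟ v))
  field
    fourValent : ∀ v → degree v ≡ 4

module _ (G : FeynmanGraph) where
  open FeynmanGraph G

  Adjacent : Fin nI → Fin nV → Fin nV → Set
  Adjacent e v u = (ends e ≡ (v , u)) ⊎ (ends e ≡ (u , v))

  data Path (P : Fin nI → Set) : Fin nV → Fin nV → Set where
    here : ∀ {v} → Path P v v
    step : ∀ {v u w} (e : Fin nI) → P e → Adjacent e v u → Path P u w → Path P v w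

  Connected : Set
  Connected = Fin nV × (∀ v w → Path (λ _ → ⊤) v w)

  OnePI : Set
  OnePI = Connected × (∀ (e : Fin nI) v w → Path (λ e' → ¬ (e' ≡ e)) v w)

  record Subgraph : Set₁ where
    field
      verts : Fin nV → Set
      edges : Fin nI → Set
  open Subgraph public

  SameGraph : Subgraph → Subgraph → Set
  SameGraph g h = (∀ w → verts g w ⇔ verts h w) × (∀ e → edges g e ⇔ edges h e)

  SubgraphOf : Subgraph → Subgraph → Set
  SubgraphOf g h = (∀ w → verts g w → verts h w) × (∀ e → edges g e → edges h e)

  wholeGraph : Subgraph
  wholeGraph = record { verts = λ _ → ⊤ ; edges = λ _ → ⊤ }

record ScaleAssignment (G : FeynmanGraph) (ρ : ℕ) : Set where
  open FeynmanGraph G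
  field
    μI : Fin nI → ℕ
    μX : Fin nX → ℕ
    μI≤ρ : ∀ e → μI e ≤ ρ
    μX≤ρ : ∀ x → μX x ≤ ρ

module GN (G : FeynmanGraph) (ρ : ℕ) (μ : ScaleAssignment G ρ) where
  open FeynmanGraph G
  open ScaleAssignment μ

  HighEdge : ℕ → Fin nI → Set
  HighEdge i e = i ≤ μI e

  component : ℕ → Fin nV → Subgraph G
  component i v = record
    { verts = λ w → Path G (HighEdge i) v w
    ; edges = λ e → HighEdge i e × Path G (HighEdge i) v (proj₁ (ends e)) }

  -- a node of the tree at distance i from the root, named by a vertex of its component
  record Node : Set where
    constructor node
    field
      level : ℕ
      level≤ρ : level ≤ ρ
      rep : Fin nV
  open Node public

  decoration : Node → Subgraph G
  decoration a = component (level a) (rep a)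

  -- two names denote the same node of the tree
  SameNode : Node → Node → Set
  SameNode a b = (level a ≡ level b) × SameGraph G (decoration a) (decoration b)

  Arrow : Node → Node → Set
  Arrow c p = (level c ≡ suc (level p)) × SubgraphOf G (decoration c) (decoration p)

  data Desc : Node → Node → Set where
    self : ∀ {a} → Desc a a
    via  : ∀ {d p a} → Arrow d p → Desc p a → Desc d a

  Leaf : Node → Set
  Leaf a = ∀ c → ¬ Arrow c a

  ScaleAppears : ℕ → Set
  ScaleAppears i = Σ (Fin nI) (λ e → μI e ≡ i) ⊎ Σ (Fin nX) (λ x → μX x ≡ i)

-- A node at distance i from the root is named by a vertex v and decorated by
-- the component G^i_v of v in the subgraph of internal edges of scale ≥ i.
-- After basic facts on paths (PathFacts), everything follows from three facts
-- about these components (module Components):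
--   * raising the threshold only shrinks components (componentShrinks), so the
--     node (i+1, v) is a child of (i, v) whenever i < ρ: leaves sit at ρ;
--   * at threshold 0 every edge is admissible, so by connectedness the
--     component of any vertex is the whole graph: the root is G;
--   * if no internal edge has its scale in [j, l), the edge sets of scale ≥ j
--     and ≥ l coincide, so G^l_v = G^j_u whenever u, v are joined in G^j
--     (componentStable).
-- Following arrows down from a node r, every descendant d lies deeper than r
-- and its vertex is reachable from that of r inside G^{level r}
-- (descendantReachable).  Part (3) combines the last two facts: across a gap
-- [j, k] of scales every node below r up to level k is decorated like r, so
-- equal-level nodes coincide and the subtree does not branch.
-- The theorem itself only assembles rootIsWholeGraph, leafAtCutoff,
-- gapDescendant and gapNoBranching.
module Submission where

open import Defs
open import Data.Nat using (ℕ; suc; _≤_; _<_; z≤n)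
open import Data.Nat.Properties using (≤-trans; ≤-refl; n≤1+n; ≤∧≢⇒<; <⇒≤; ≰⇒>; _≤?_; _≟_)
open import Data.Fin using (Fin)
open import Data.Product using (_×_; _,_; proj₁; proj₂; Σ)
open import Data.Sum using (inj₁; inj₂)
open import Data.Unit using (tt)
open import Data.Empty using (⊥-elim)
open import Relation.Nullary using (¬_; yes; no)
open import Relation.Binary.PropositionalEquality using (_≡_; refl; sym; subst)
open import Function.Bundles using (mk⇔)
import Function.Properties.Equivalence as ⇔

module PathFacts (G : FeynmanGraph) where
  open FeynmanGraph G

  mapPath : ∀ {P Q : Fin nI → Set} → (∀ e → P e → Q e) →
            ∀ {v w} → Path G P v w → Path G Q v w
  mapPath P⊆Q here             = here
  mapPath P⊆Q (step e p adj r) = step e (P⊆Q e p) adj (mapPath P⊆Q r)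

  _++ₚ_ : ∀ {P u v w} → Path G P u v → Path G P v w → Path G P u w
  here             ++ₚ q = q
  step e p adj r   ++ₚ q = step e p adj (r ++ₚ q)

  adjacentSym : ∀ {e v u} → Adjacent G e v u → Adjacent G e u v
  adjacentSym (inj₁ x) = inj₂ x
  adjacentSym (inj₂ y) = inj₁ y

  reversePath : ∀ {P v w} → Path G P v w → Path G P w v
  reversePath here             = here
  reversePath (step e p adj r) = reversePath r ++ₚ step e p (adjacentSym adj) here

  sameGraphSym : ∀ {g h} → SameGraph G g h → SameGraph G h g
  sameGraphSym (vs , es) = (λ w → ⇔.sym (vs w)) , (λ e → ⇔.sym (es e))

  sameGraphTrans : ∀ {g h k} → SameGraph G g h → SameGraph G h k → SameGraph G g k
  sameGraphTrans (vs , es) (vs′ , es′) =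
    (λ w → ⇔.trans (vs w) (vs′ w)) , (λ e → ⇔.trans (es e) (es′ e))

module Components (G : FeynmanGraph) (ρ : ℕ) (μ : ScaleAssignment G ρ) where
  open FeynmanGraph G
  open ScaleAssignment μ
  open GN G ρ μ
  open PathFacts G

  highEdgeAntitone : ∀ {i l} → i ≤ l → ∀ e → HighEdge l e → HighEdge i e
  highEdgeAntitone i≤l e l≤μe = ≤-trans i≤l l≤μe

  componentShrinks : ∀ {i l u v} → i ≤ l → Path G (HighEdge i) u v →
                     SubgraphOf G (component l v) (component i u)
  componentShrinks i≤l u⇝v =
    (λ w v⇝w → u⇝v ++ₚ mapPath (highEdgeAntitone i≤l) v⇝w) ,
    (λ e (high , v⇝e) → highEdgeAntitone i≤l e high ,
                        (u⇝v ++ₚ mapPath (highEdgeAntitone i≤l) v⇝e))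

  componentStable : ∀ {j l u v} → j ≤ l → (∀ e → HighEdge j e → HighEdge l e) →
                    Path G (HighEdge j) u v → SameGraph G (component l v) (component j u)
  componentStable {j} {l} {u} {v} j≤l j⊆l u⇝v =
    (λ w → mk⇔ (proj₁ shrink w) (λ u⇝w → mapPath j⊆l (v⇝u ++ₚ u⇝w))) ,
    (λ e → mk⇔ (proj₂ shrink e)
                (λ (high , u⇝e) → j⊆l e high , mapPath j⊆l (v⇝u ++ₚ u⇝e)))
    where
    shrink : SubgraphOf G (component l v) (component j u)
    shrink = componentShrinks j≤l u⇝v
    v⇝u : Path G (HighEdge j) v u
    v⇝u = reversePath u⇝v

  componentAtZero : Connected G → ∀ v → SameGraph G (component 0 v) (wholeGraph G)
  componentAtZero (_ , conn) v =
    (λ w → mk⇔ (λ _ → tt) (λ _ → mapPath (λ _ _ → z≤n) (conn v w))) ,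
    (λ e → mk⇔ (λ _ → tt) (λ _ → z≤n , mapPath (λ _ _ → z≤n) (conn v _)))

  rootIsWholeGraph : Connected G → (r : Node) → level r ≡ 0 →
                     SameGraph G (decoration r) (wholeGraph G)
  rootIsWholeGraph connected (node .0 _ v) refl = componentAtZero connected v

  childBelowCutoff : (a : Node) → level a < ρ → Σ Node (λ c → Arrow c a)
  childBelowCutoff (node l _ v) l<ρ =
    node (suc l) l<ρ v , refl , componentShrinks (n≤1+n l) here

  leafAtCutoff : (a : Node) → Leaf a → level a ≡ ρ
  leafAtCutoff a leaf with level a ≟ ρ
  ... | yes a≡ρ = a≡ρ
  ... | no  a≢ρ with childBelowCutoff a (≤∧≢⇒< (level≤ρ a) a≢ρ)
  ...   | c , c→a = ⊥-elim (leaf c c→a)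

  descendantReachable : ∀ {d r} → Desc d r →
                        (level r ≤ level d) × Path G (HighEdge (level r)) (rep r) (rep d)
  descendantReachable self = ≤-refl , here
  descendantReachable {d} (via (level≡ , d⊆p) p≤r) with descendantReachable p≤r
  ... | r≤p , r⇝p =
    subst (_ ≤_) (sym level≡) (≤-trans r≤p (n≤1+n _)) ,
    (r⇝p ++ₚ mapPath (highEdgeAntitone r≤p) (proj₁ d⊆p (rep d) here))

  gapHighEdges : ∀ {j k} → (∀ i → j ≤ i → i ≤ k → ¬ ScaleAppears i) →
                 ∀ {l} → l ≤ k → ∀ e → HighEdge j e → HighEdge l e
  gapHighEdges gap {l} l≤k e j≤μe with l ≤? μI e
  ... | yes l≤μe = l≤μe
  ... | no  l≰μe = ⊥-elim (gap (μI e) j≤μe (≤-trans (<⇒≤ (≰⇒> l≰μe)) l≤k) (inj₁ (e , refl)))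

  gapDescendant : ∀ {j k} → (∀ i → j ≤ i → i ≤ k → ¬ ScaleAppears i) →
                  (r : Node) → level r ≡ j → (d : Node) → Desc d r → level d ≤ k →
                  SameGraph G (decoration d) (decoration r)
  gapDescendant gap r refl d d≤r d≤k with descendantReachable d≤r
  ... | r≤d , r⇝d = componentStable r≤d (gapHighEdges gap d≤k) r⇝d

  -- Two descendants of r of equal level across the gap are both decorated
  -- like r, hence name the same node: the subtree does not branch.
  gapNoBranching : ∀ {j k} → (∀ i → j ≤ i → i ≤ k → ¬ ScaleAppears i) →
                   (r : Node) → level r ≡ j → (d d′ : Node) → Desc d r → Desc d′ r →
                   level d ≡ level d′ → level d ≤ k → SameNode d d′
  gapNoBranching {k = k} gap r r≡j d d′ d≤r d′≤r d≡d′ d≤k =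
    d≡d′ , sameGraphTrans (gapDescendant gap r r≡j d d≤r d≤k)
                          (sameGraphSym (gapDescendant gap r r≡j d′ d′≤r d′≤k))
    where
    d′≤k : level d′ ≤ k
    d′≤k = subst (_≤ k) d≡d′ d≤k

mainTheorem2 : (G : FeynmanGraph) → OnePI G → (ρ : ℕ) → (μ : ScaleAssignment G ρ) →
    let open GN G ρ μ in
      ((r : Node) → level r ≡ 0 → SameGraph G (decoration r) (wholeGraph G))
      × ((a : Node) → Leaf a → level a ≡ ρ)
      × ((j k : ℕ) → j ≤ k → k ≤ ρ → (∀ i → j ≤ i → i ≤ k → ¬ ScaleAppears i) →
          (r : Node) → level r ≡ j →
            ((d : Node) → Desc d r → level d ≤ k → SameGraph G (decoration d) (decoration r))
            × ((d d′ : Node) → Desc d r → Desc d′ r → level d ≡ level d′ → level d ≤ k →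
                SameNode d d′))
mainTheorem2 G (connected , _) ρ μ =
  rootIsWholeGraph connected ,
  leafAtCutoff ,
  λ j k _ _ gap r r≡j → gapDescendant gap r r≡j , gapNoBranching gap r r≡j
  where open Components G ρ μ
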